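{- For all environments $\Gamma,\Gamma',\Gamma''$, linear types $L,L',L''$ and polarities $a\in\{+,-\}$: (i) $L\le^a_0L'$ iff $L=L'$; $\Gamma\le^a_0\Gamma'$ iff $\Gamma=\Gamma'$; hence $(\Gamma,L)\le^a_0(\Gamma',L')$ iff $\Gamma=\Gamma'$ and $L=L'$. (ii) For every multi types $M,M'$, variable $x$ (not in the supports of $\Gamma,\Gamma'$), color $c\in\{\circ,\bullet\}$ and $k\in\mathbb{N}$: $(\Gamma',x:M',L')\le^a_k(\Gamma,x:M,L)$ — i.e. $((\Gamma',x:M'),L')\le^a_k((\Gamma,x:M),L)$ — iff $(\Gamma',M'\to_cL')\le^a_k(\Gamma,M\to_cL)$. (iii) If $(\Gamma,L)\le^a_{k_1}(\Gamma',L')$ and $(\Gamma',L')\le^a_{k_2}(\Gamma'',L'')$ then $(\Gamma,L)\le^a_{k_1+k_2}(\Gamma'',L'')$.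
   Context: Types: linear $L ::= X\mid M\to_cL$ ($X$ atoms, $c\in\{\circ,\bullet\}$); multi $M ::= [L_1,\ldots,L_n]$ (finite multisets). Environments $\Gamma$ map variables to multi types with finite support; $\Gamma,x:M$ extends $\Gamma$ with $x\notin\mathrm{supp}(\Gamma)$. Polarized whitening $\le^a_k$ ($a\in\{+,-\}$, $\bar a$ opposite), on linear and multi types by mutual induction: $X\le^a_0X$; if $M'\le^-_{k_1}M$, $L'\le^+_{k_2}L$ then $(M'\to_\circ L')\le^+_{k_1+k_2+1}(M\to_\bullet L)$; for any $c$, if $M'\le^{\bar a}_{k_1}M$, $L'\le^a_{k_2}L$ then $(M'\to_cL')\le^a_{k_1+k_2}(M\to_cL)$; $[L'_1,\ldots,L'_n]\le^a_{\sum k_i}[L_1,\ldots,L_n]$ when $L'_i\le^a_{k_i}L_i$; no other rules. Environments: $\emptyset\le^a_0\emptyset$, and if $\Gamma'\le^a_{k_1}\Gamma$ and $M'\le^a_{k_2}M$ then $(\Gamma',x:M')\le^a_{k_1+k_2}(\Gamma,x:M)$. Pairs: $(\Gamma',L')\le^a_{k_1+k_2}(\Gamma,L)$ iff $\Gamma'\le^{\bar a}_{k_1}\Gamma$ and $L'\le^a_{k_2}L$. -}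

module Defs where

open import Data.Nat using (ℕ; zero; suc; _+_; _≤_; _⊔_; _≟_)
open import Data.Nat.Properties using (≤-trans; m≤m⊔n; m≤n⊔m; <-irrefl; ≤-refl)
open import Data.List using (List; []; _∷_)
open import Data.List.Relation.Binary.Permutation.Propositional using (_↭_)
open import Data.Product using (Σ; _×_; _,_; ∃-syntax)
open import Data.Bool using (if_then_else_)
open import Relation.Nullary using (yes; no; does)
open import Relation.Binary.PropositionalEquality using (_≡_; refl)

Atom : Set
Atom = ℕ

Var : Set
Var = ℕ

data Color : Set where
  ∘ ● : Color

-- Linear types  L ::= X | M →c L ; multi types M are finite multisets of
-- linear types, represented by lists (identified up to permutation, see _≈M_).
data LType : Set where
  atom  : Atom → LType
  arr   : List LType → Color → LType → LType

MType : Set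
MType = List LType

mutual
  data _≈L_ : LType → LType → Set where
    atom : ∀ {X} → atom X ≈L atom X
    arr  : ∀ {M M' L L' c} → M ≈M M' → L ≈L L' → arr M c L ≈L arr M' c L'

  data _≈P_ : MType → MType → Set where
    []  : [] ≈P []
    _∷_ : ∀ {L L' Ms Ms'} → L ≈L L' → Ms ≈P Ms' → (L ∷ Ms) ≈P (L' ∷ Ms')

  data _≈M_ : MType → MType → Set where
    perm : ∀ {Ms Ns Ms'} → Ms ≈P Ns → Ns ↭ Ms' → Ms ≈M Ms'

data Pol : Set where
  pos neg : Pol

opp : Pol → Pol
opp pos = neg
opp neg = pos

-- Polarized whitening on linear and multi types.
-- L' ≤L⟨ a , k ⟩ L  stands for  L' ≤^a_k L.

mutual
  data _≤L⟨_,_⟩_ : LType → Pol → ℕ → LType → Set where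
    atom  : ∀ {X a} → atom X ≤L⟨ a , 0 ⟩ atom X
    white : ∀ {M M' L L' k₁ k₂} →
            M' ≤M⟨ neg , k₁ ⟩ M → L' ≤L⟨ pos , k₂ ⟩ L →
            arr M' ∘ L' ≤L⟨ pos , k₁ + k₂ + 1 ⟩ arr M ● L
    arr   : ∀ {M M' L L' c a k₁ k₂} →
            M' ≤M⟨ opp a , k₁ ⟩ M → L' ≤L⟨ a , k₂ ⟩ L →
            arr M' c L' ≤L⟨ a , k₁ + k₂ ⟩ arr M c L

  data _≤P⟨_,_⟩_ : MType → Pol → ℕ → MType → Set where
    []  : ∀ {a} → [] ≤P⟨ a , 0 ⟩ []
    _∷_ : ∀ {L L' Ms Ms' a k₁ k₂} →
          L' ≤L⟨ a , k₁ ⟩ L → Ms' ≤P⟨ a , k₂ ⟩ Ms →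
          (L' ∷ Ms') ≤P⟨ a , k₁ + k₂ ⟩ (L ∷ Ms)

  data _≤M⟨_,_⟩_ : MType → Pol → ℕ → MType → Set where
    perm : ∀ {Ms' Ns Ms a k} →
           Ms' ≤P⟨ a , k ⟩ Ns → Ns ↭ Ms → Ms' ≤M⟨ a , k ⟩ Ms

-- Environments: maps from variables to multi types with finite support
-- (x is in the support of Γ iff Γ x is not the empty multiset).

record Env : Set where
  constructor env
  field
    fun    : Var → MType
    bound  : ℕ
    finite : ∀ y → bound ≤ y → fun y ≡ []
open Env public

∅ : Env
∅ = env (λ _ → []) 0 (λ _ _ → refl)

_∉supp_ : Var → Env → Set
x ∉supp Γ = fun Γ x ≡ []

-- the update Γ[x ↦ M]; written Γ , x : M  when x ∉ supp(Γ)
_,_∶_ : Env → Var → MType → Env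
Γ , x ∶ M = env f (bound Γ ⊔ suc x) fin
  where
  f : Var → MType
  f y with y ≟ x
  ... | yes _ = M
  ... | no _ = fun Γ y
  fin : ∀ y → bound Γ ⊔ suc x ≤ y → f y ≡ []
  fin y le with y ≟ x
  ... | yes refl = Data.Empty.⊥-elim (<-irrefl refl (≤-trans (m≤n⊔m (bound Γ) (suc x)) le))
    where import Data.Empty
  ... | no _ = finite Γ y (≤-trans (m≤m⊔n (bound Γ) (suc x)) le)

_≈E_ : Env → Env → Set
Γ ≈E Γ' = ∀ y → fun Γ y ≈M fun Γ' y

-- Since environments are maps, the conclusion is stated up to equality of maps.
data _≤E⟨_,_⟩_ : Env → Pol → ℕ → Env → Set where
  emp : ∀ {Δ' Δ a} → Δ' ≈E ∅ → Δ ≈E ∅ → Δ' ≤E⟨ a , 0 ⟩ Δ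
  ext : ∀ {Δ' Δ Γ' Γ x M' M a k₁ k₂} →
        Γ' ≤E⟨ a , k₁ ⟩ Γ → x ∉supp Γ' → x ∉supp Γ →
        M' ≤M⟨ a , k₂ ⟩ M →
        Δ' ≈E (Γ' , x ∶ M') → Δ ≈E (Γ , x ∶ M) →
        Δ' ≤E⟨ a , k₁ + k₂ ⟩ Δ

_≤⟨_,_⟩_ : Env × LType → Pol → ℕ → Env × LType → Set
(Γ' , L') ≤⟨ a , k ⟩ (Γ , L) =
  ∃[ k₁ ] ∃[ k₂ ] (k ≡ k₁ + k₂ × Γ' ≤E⟨ opp a , k₁ ⟩ Γ × L' ≤L⟨ a , k₂ ⟩ L)

{-# OPTIONS --safe #-}
-- Weight zero forces equality because only the rule (M' →∘ L') ≤⁺ (M →● L)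
-- carries weight. Transitivity on types is a simultaneous induction once the
-- permutations allowed on multi types are pushed through positional
-- whitening. Environments are built by extensions in an arbitrary order and
-- only up to equality of maps, so they are compared through a pointwise
-- characterisation: Γ' ≤ᵃₖ Γ iff for some n bounding both supports one has
-- Γ' y ≤ᵃ_{k_y} Γ y for every y < n, with k = Σ k_y. Transitivity, weight
-- zero, and splitting off the entry of x are then all pointwise; (ii) only
-- moves the weight of x between the environment and the arrow.
module Submission where

open import Defs
import Data.Nat.Properties as ℕ
open import Algebra.Properties.CommutativeSemigroup ℕ.+-commutativeSemigroup
  using (interchange; x∙yz≈y∙xz; xy∙z≈xz∙y)
open import Data.Empty using (⊥-elim)
open import Data.List using ([]; _∷_)
open import Data.List.Relation.Binary.Permutation.Propositional
  using (_↭_; refl; prep; swap; trans; ↭-sym)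
open import Data.List.Relation.Binary.Permutation.Propositional.Properties using (↭-empty-inv)
open import Data.Nat using (ℕ; zero; suc; _+_; _≤_; _<_; _≤′_; ≤′-refl; ≤′-step; _≟_; _<?_; _⊔_)
open import Data.Nat.Properties
  using (+-identityʳ; +-assoc; m+n≡0⇒m≡0; m+n≡0⇒n≡0; m+1+n≢0; ≤-refl; ≤-pred; n≤1+n;
         m<n⇒m<1+n; <-≤-trans; >⇒≢; <⇒≢; ≤∧≢⇒<; ≮⇒≥; ≤⇒≤′; ≤′⇒≤; m≤m⊔n; m≤n⊔m)
open import Data.Nat.Tactic.RingSolver using (solve-∀)
open import Data.Product using (_×_; _,_; ∃-syntax)
open import Function.Bundles using (_⇔_; mk⇔)
open import Relation.Nullary using (yes; no)
open import Relation.Binary.PropositionalEquality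
  using (_≡_; _≢_; refl; cong; subst₂; ≢-sym)
import Relation.Binary.PropositionalEquality as ≡

≤L-cast : ∀ {L' L a k k'} → k ≡ k' → L' ≤L⟨ a , k ⟩ L → L' ≤L⟨ a , k' ⟩ L
≤L-cast refl w = w

≤P-cast : ∀ {Ms' Ms a k k'} → k ≡ k' → Ms' ≤P⟨ a , k ⟩ Ms → Ms' ≤P⟨ a , k' ⟩ Ms
≤P-cast refl w = w

≤M-cast : ∀ {M' M a k k'} → k ≡ k' → M' ≤M⟨ a , k ⟩ M → M' ≤M⟨ a , k' ⟩ M
≤M-cast refl w = w

↭-≤P⇒≤P-↭ : ∀ {Ns Ms Ms' a k} → Ns ↭ Ms → Ms ≤P⟨ a , k ⟩ Ms' →
            ∃[ Ks ] (Ns ≤P⟨ a , k ⟩ Ks × Ks ↭ Ms')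
↭-≤P⇒≤P-↭ refl w = _ , w , refl
↭-≤P⇒≤P-↭ (prep _ π) (v ∷ w) with ↭-≤P⇒≤P-↭ π w
... | Ks , w' , ρ = _ , v ∷ w' , prep _ ρ
↭-≤P⇒≤P-↭ (swap _ _ π) (_∷_ {k₁ = i} u (_∷_ {k₁ = j} {k₂ = l} v w)) with ↭-≤P⇒≤P-↭ π w
... | Ks , w' , ρ = _ , ≤P-cast (x∙yz≈y∙xz j i l) (v ∷ (u ∷ w')) , swap _ _ ρ
↭-≤P⇒≤P-↭ (trans π₁ π₂) w with ↭-≤P⇒≤P-↭ π₂ w
... | Ks₂ , w₂ , ρ₂ with ↭-≤P⇒≤P-↭ π₁ w₂
... | Ks₁ , w₁ , ρ₁ = Ks₁ , w₁ , trans ρ₁ ρ₂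

mutual
  ≤L-trans : ∀ {L₁ L₂ L₃ a k₁ k₂} → L₁ ≤L⟨ a , k₁ ⟩ L₂ → L₂ ≤L⟨ a , k₂ ⟩ L₃ →
             L₁ ≤L⟨ a , k₁ + k₂ ⟩ L₃
  ≤L-trans atom atom = atom
  ≤L-trans (white {k₁ = i₁} {k₂ = j₁} m l) (arr {k₁ = i₂} {k₂ = j₂} m' l') =
    ≤L-cast (reassoc i₁ j₁ i₂ j₂) (white (≤M-trans m m') (≤L-trans l l'))
    where
    reassoc : ∀ a b c d → (a + c) + (b + d) + 1 ≡ (a + b + 1) + (c + d)
    reassoc = solve-∀
  ≤L-trans (arr {a = pos} {k₁ = i₁} {k₂ = j₁} m l) (white {k₁ = i₂} {k₂ = j₂} m' l') =
    ≤L-cast (reassoc i₁ j₁ i₂ j₂) (white (≤M-trans m m') (≤L-trans l l'))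
    where
    reassoc : ∀ a b c d → (a + c) + (b + d) + 1 ≡ (a + b) + (c + d + 1)
    reassoc = solve-∀
  ≤L-trans (arr {k₁ = i₁} {k₂ = j₁} m l) (arr {k₁ = i₂} {k₂ = j₂} m' l') =
    ≤L-cast (≡.sym (interchange i₁ j₁ i₂ j₂)) (arr (≤M-trans m m') (≤L-trans l l'))

  ≤P-trans : ∀ {Ms₁ Ms₂ Ms₃ a k₁ k₂} → Ms₁ ≤P⟨ a , k₁ ⟩ Ms₂ → Ms₂ ≤P⟨ a , k₂ ⟩ Ms₃ →
             Ms₁ ≤P⟨ a , k₁ + k₂ ⟩ Ms₃
  ≤P-trans [] [] = []
  ≤P-trans (_∷_ {k₁ = i₁} {k₂ = j₁} u w) (_∷_ {k₁ = i₂} {k₂ = j₂} u' w') =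
    ≤P-cast (≡.sym (interchange i₁ j₁ i₂ j₂)) (≤L-trans u u' ∷ ≤P-trans w w')

  ≤M-trans : ∀ {M₁ M₂ M₃ a k₁ k₂} → M₁ ≤M⟨ a , k₁ ⟩ M₂ → M₂ ≤M⟨ a , k₂ ⟩ M₃ →
             M₁ ≤M⟨ a , k₁ + k₂ ⟩ M₃
  ≤M-trans (perm w₁ π₁) (perm w₂ π₂) with ↭-≤P⇒≤P-↭ π₁ w₂
  ... | _ , w₂' , π₁' = perm (≤P-trans w₁ w₂') (trans π₁' π₂)

mutual
  ≈L⇒≤L₀ : ∀ {L' L a} → L' ≈L L → L' ≤L⟨ a , 0 ⟩ L
  ≈L⇒≤L₀ atom = atom
  ≈L⇒≤L₀ (arr m l) = arr (≈M⇒≤M₀ m) (≈L⇒≤L₀ l)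

  ≈P⇒≤P₀ : ∀ {Ms' Ms a} → Ms' ≈P Ms → Ms' ≤P⟨ a , 0 ⟩ Ms
  ≈P⇒≤P₀ [] = []
  ≈P⇒≤P₀ (l ∷ p) = ≈L⇒≤L₀ l ∷ ≈P⇒≤P₀ p

  ≈M⇒≤M₀ : ∀ {M' M a} → M' ≈M M → M' ≤M⟨ a , 0 ⟩ M
  ≈M⇒≤M₀ (perm p π) = perm (≈P⇒≤P₀ p) π

mutual
  ≤L₀⇒≈L : ∀ {L' L a k} → L' ≤L⟨ a , k ⟩ L → k ≡ 0 → L' ≈L L
  ≤L₀⇒≈L atom _ = atom
  ≤L₀⇒≈L (white {k₁ = i} {k₂ = j} _ _) k≡0 with m+1+n≢0 (i + j) k≡0
  ... | ()
  ≤L₀⇒≈L (arr {k₁ = i} m l) k≡0 = arr (≤M₀⇒≈M m (m+n≡0⇒m≡0 i k≡0)) (≤L₀⇒≈L l (m+n≡0⇒n≡0 i k≡0))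

  ≤P₀⇒≈P : ∀ {Ms' Ms a k} → Ms' ≤P⟨ a , k ⟩ Ms → k ≡ 0 → Ms' ≈P Ms
  ≤P₀⇒≈P [] _ = []
  ≤P₀⇒≈P (_∷_ {k₁ = i} u w) k≡0 = ≤L₀⇒≈L u (m+n≡0⇒m≡0 i k≡0) ∷ ≤P₀⇒≈P w (m+n≡0⇒n≡0 i k≡0)

  ≤M₀⇒≈M : ∀ {M' M a k} → M' ≤M⟨ a , k ⟩ M → k ≡ 0 → M' ≈M M
  ≤M₀⇒≈M (perm w π) k≡0 = perm (≤P₀⇒≈P w k≡0) π

mutual
  ≈L-refl : ∀ {L} → L ≈L L
  ≈L-refl {atom _} = atom
  ≈L-refl {arr _ _ _} = arr ≈M-refl ≈L-refl

  ≈P-refl : ∀ {Ms} → Ms ≈P Ms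
  ≈P-refl {[]} = []
  ≈P-refl {_ ∷ _} = ≈L-refl ∷ ≈P-refl

  ≈M-refl : ∀ {M} → M ≈M M
  ≈M-refl = perm ≈P-refl refl

mutual
  ≈L-sym : ∀ {L' L} → L' ≈L L → L ≈L L'
  ≈L-sym atom = atom
  ≈L-sym (arr m l) = arr (≈M-sym m) (≈L-sym l)

  ≈P-sym : ∀ {Ms' Ms} → Ms' ≈P Ms → Ms ≈P Ms'
  ≈P-sym [] = []
  ≈P-sym (l ∷ p) = ≈L-sym l ∷ ≈P-sym p

  ≈M-sym : ∀ {M' M} → M' ≈M M → M ≈M M'
  ≈M-sym (perm p π) with ↭-≤P⇒≤P-↭ (↭-sym π) (≈P⇒≤P₀ {a = pos} (≈P-sym p))
  ... | _ , w , ρ = perm (≤P₀⇒≈P w refl) ρ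

≈M-trans : ∀ {M₁ M₂ M₃} → M₁ ≈M M₂ → M₂ ≈M M₃ → M₁ ≈M M₃
≈M-trans p q = ≤M₀⇒≈M (≤M-trans (≈M⇒≤M₀ {a = pos} p) (≈M⇒≤M₀ q)) refl

≡⇒≈M : ∀ {M' M} → M' ≡ M → M' ≈M M
≡⇒≈M refl = ≈M-refl

≈M[]⇒≡[] : ∀ {M} → M ≈M [] → M ≡ []
≈M[]⇒≡[] (perm p π) with refl ← ↭-empty-inv π with p
... | [] = refl

[]≤M⇒≡0 : ∀ {M a k} → [] ≤M⟨ a , k ⟩ M → k ≡ 0
[]≤M⇒≡0 (perm [] _) = refl

[]≤M[] : ∀ {a} → [] ≤M⟨ a , 0 ⟩ []
[]≤M[] = perm [] refl

<-pred-≢ : ∀ {x m} → x < suc m → m ≢ x → x < m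
<-pred-≢ x<1+m m≢x = ≤∧≢⇒< (≤-pred x<1+m) (≢-sym m≢x)

update-≡ : ∀ Γ x M → fun (Γ , x ∶ M) x ≡ M
update-≡ Γ x M with x ≟ x
... | yes _ = refl
... | no x≢x = ⊥-elim (x≢x refl)

update-≢ : ∀ Γ x M y → y ≢ x → fun (Γ , x ∶ M) y ≡ fun Γ y
update-≢ Γ x M y y≢x with y ≟ x
... | yes y≡x = ⊥-elim (y≢x y≡x)
... | no _ = refl

Vanishes : ℕ → (Var → MType) → Set
Vanishes n f = ∀ y → n ≤ y → f y ≡ []

vanishes-mono : ∀ {m n f} → Vanishes m f → m ≤ n → Vanishes n f
vanishes-mono v m≤n y n≤y = v y (ℕ.≤-trans m≤n n≤y)

update-vanishes : ∀ {n Γ x M} → Vanishes n (fun Γ) → x < n → Vanishes n (fun (Γ , x ∶ M))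
update-vanishes {Γ = Γ} {x} {M} v x<n y n≤y =
  ≡.trans (update-≢ Γ x M y (>⇒≢ (<-≤-trans x<n n≤y))) (v y n≤y)

update-vanishes⁻¹ : ∀ {n Γ x M} → Vanishes n (fun (Γ , x ∶ M)) → x < n → Vanishes n (fun Γ)
update-vanishes⁻¹ {Γ = Γ} {x} {M} v x<n y n≤y =
  ≡.trans (≡.sym (update-≢ Γ x M y (>⇒≢ (<-≤-trans x<n n≤y)))) (v y n≤y)

data _≤[_]⟨_,_⟩_ (f' : Var → MType) : ℕ → Pol → ℕ → (Var → MType) → Set where
  []   : ∀ {f a} → f' ≤[ 0 ]⟨ a , 0 ⟩ f
  _∷ʳ_ : ∀ {f n a k₁ k₂} → f' ≤[ n ]⟨ a , k₁ ⟩ f → f' n ≤M⟨ a , k₂ ⟩ f n →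
         f' ≤[ suc n ]⟨ a , k₁ + k₂ ⟩ f

≤[]-cast : ∀ {f' f n a k k'} → k ≡ k' → f' ≤[ n ]⟨ a , k ⟩ f → f' ≤[ n ]⟨ a , k' ⟩ f
≤[]-cast refl w = w

≤[]-resp : ∀ {f' f g' g n a k} → f' ≤[ n ]⟨ a , k ⟩ f →
           (∀ y → y < n → g' y ≈M f' y) → (∀ y → y < n → f y ≈M g y) →
           g' ≤[ n ]⟨ a , k ⟩ g
≤[]-resp [] _ _ = []
≤[]-resp (_∷ʳ_ {n = n} {k₂ = k₂} w wₙ) e' e =
  ≤[]-resp w (λ y y<n → e' y (m<n⇒m<1+n y<n)) (λ y y<n → e y (m<n⇒m<1+n y<n))
  ∷ʳ ≤M-cast (+-identityʳ k₂) (≤M-trans (≤M-trans (≈M⇒≤M₀ (e' n ≤-refl)) wₙ) (≈M⇒≤M₀ (e n ≤-refl)))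

≤[]-pad : ∀ {f' f m n a k} → f' ≤[ m ]⟨ a , k ⟩ f → Vanishes m f' → Vanishes m f → m ≤ n →
          f' ≤[ n ]⟨ a , k ⟩ f
≤[]-pad {f'} {f} {m} {a = a} {k} w v' v m≤n = pad (≤⇒≤′ m≤n)
  where
  pad : ∀ {n} → m ≤′ n → f' ≤[ n ]⟨ a , k ⟩ f
  pad ≤′-refl = w
  pad {suc n} (≤′-step m≤′n) =
    ≤[]-cast (+-identityʳ k)
      (pad m≤′n ∷ʳ subst₂ (_≤M⟨ a , 0 ⟩_) (≡.sym (v' n (≤′⇒≤ m≤′n))) (≡.sym (v n (≤′⇒≤ m≤′n))) []≤M[])

≤[]-trans : ∀ {f g h n a k₁ k₂} → f ≤[ n ]⟨ a , k₁ ⟩ g → g ≤[ n ]⟨ a , k₂ ⟩ h →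
            f ≤[ n ]⟨ a , k₁ + k₂ ⟩ h
≤[]-trans [] [] = []
≤[]-trans (_∷ʳ_ {k₁ = i₁} {k₂ = j₁} w u) (_∷ʳ_ {k₁ = i₂} {k₂ = j₂} w' u') =
  ≤[]-cast (≡.sym (interchange i₁ j₁ i₂ j₂)) (≤[]-trans w w' ∷ʳ ≤M-trans u u')

≤[]₀⇒≈ : ∀ {f' f n a k} → f' ≤[ n ]⟨ a , k ⟩ f → k ≡ 0 → ∀ y → y < n → f' y ≈M f y
≤[]₀⇒≈ (_∷ʳ_ {n = m} {k₁ = i} w wₘ) k≡0 y y<1+m with m ≟ y
... | yes refl = ≤M₀⇒≈M wₘ (m+n≡0⇒n≡0 i k≡0)
... | no m≢y = ≤[]₀⇒≈ w (m+n≡0⇒m≡0 i k≡0) y (<-pred-≢ y<1+m m≢y)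

≈⇒≤[]₀ : ∀ {f' f a} n → (∀ y → y < n → f' y ≈M f y) → f' ≤[ n ]⟨ a , 0 ⟩ f
≈⇒≤[]₀ zero _ = []
≈⇒≤[]₀ (suc n) e = ≈⇒≤[]₀ n (λ y y<n → e y (m<n⇒m<1+n y<n)) ∷ʳ ≈M⇒≤M₀ (e n ≤-refl)

≤[]-update : ∀ {f' f g' g n a k₁ k₂ x} → f' ≤[ n ]⟨ a , k₁ ⟩ f → x < n →
             f' x ≡ [] → f x ≡ [] → (∀ y → y ≢ x → g' y ≡ f' y) → (∀ y → y ≢ x → g y ≡ f y) →
             g' x ≤M⟨ a , k₂ ⟩ g x → g' ≤[ n ]⟨ a , k₁ + k₂ ⟩ g
≤[]-update {a = a} {k₂ = k₂} {x}
           (_∷ʳ_ {n = m} {k₁ = i} {k₂ = j} w wₘ) x<1+m f'x≡[] fx≡[] g'≡f' g≡f wₓ with m ≟ x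
... | yes refl rewrite []≤M⇒≡0 (subst₂ (_≤M⟨ a , j ⟩_) f'x≡[] refl wₘ) | +-identityʳ i =
  ≤[]-resp w (λ y y<m → ≡⇒≈M (g'≡f' y (<⇒≢ y<m))) (λ y y<m → ≡⇒≈M (≡.sym (g≡f y (<⇒≢ y<m))))
  ∷ʳ wₓ
... | no m≢x =
  ≤[]-cast (xy∙z≈xz∙y i k₂ j)
    (≤[]-update w (<-pred-≢ x<1+m m≢x) f'x≡[] fx≡[] g'≡f' g≡f wₓ
     ∷ʳ subst₂ (_≤M⟨ a , j ⟩_) (≡.sym (g'≡f' m m≢x)) (≡.sym (g≡f m m≢x)) wₘ)

≤[]-update⁻¹ : ∀ {f' f g' g n a k x} → g' ≤[ n ]⟨ a , k ⟩ g → x < n →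
               f' x ≡ [] → f x ≡ [] → (∀ y → y ≢ x → g' y ≡ f' y) → (∀ y → y ≢ x → g y ≡ f y) →
               ∃[ k₁ ] ∃[ k₂ ] (k ≡ k₁ + k₂ × f' ≤[ n ]⟨ a , k₁ ⟩ f × g' x ≤M⟨ a , k₂ ⟩ g x)
≤[]-update⁻¹ {a = a} {x = x}
             (_∷ʳ_ {n = m} {k₁ = i} {k₂ = j} w wₘ) x<1+m f'x≡[] fx≡[] g'≡f' g≡f with m ≟ x
... | yes refl =
  i + 0 , j , cong (_+ j) (≡.sym (+-identityʳ i)) ,
  (≤[]-resp w (λ y y<m → ≡⇒≈M (≡.sym (g'≡f' y (<⇒≢ y<m)))) (λ y y<m → ≡⇒≈M (g≡f y (<⇒≢ y<m)))
   ∷ʳ subst₂ (_≤M⟨ a , 0 ⟩_) (≡.sym f'x≡[]) (≡.sym fx≡[]) []≤M[]) ,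
  wₘ
... | no m≢x with ≤[]-update⁻¹ w (<-pred-≢ x<1+m m≢x) f'x≡[] fx≡[] g'≡f' g≡f
... | k₁ , k₂ , refl , w' , wₓ =
  k₁ + j , k₂ , xy∙z≈xz∙y k₁ k₂ j ,
  (w' ∷ʳ subst₂ (_≤M⟨ a , j ⟩_) (g'≡f' m m≢x) (g≡f m m≢x) wₘ) ,
  wₓ

record _≤ptw⟨_,_⟩_ (Δ' : Env) (a : Pol) (k : ℕ) (Δ : Env) : Set where
  constructor ptw
  field
    size       : ℕ
    vanishes'  : Vanishes size (fun Δ')
    vanishes   : Vanishes size (fun Δ)
    pointwise  : fun Δ' ≤[ size ]⟨ a , k ⟩ fun Δ

≤ptw-resp-≈E : ∀ {Δ'₀ Δ₀ Δ' Δ a k} → Δ'₀ ≤ptw⟨ a , k ⟩ Δ₀ → Δ' ≈E Δ'₀ → Δ ≈E Δ₀ →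
               Δ' ≤ptw⟨ a , k ⟩ Δ
≤ptw-resp-≈E (ptw n v' v w) e' e =
  ptw n (λ y n≤y → ≈M[]⇒≡[] (≈M-trans (e' y) (≡⇒≈M (v' y n≤y))))
        (λ y n≤y → ≈M[]⇒≡[] (≈M-trans (e y) (≡⇒≈M (v y n≤y))))
        (≤[]-resp w (λ y _ → e' y) (λ y _ → ≈M-sym (e y)))

≤ptw-extend : ∀ {Γ' Γ x M' M a k₁ k₂} → Γ' ≤ptw⟨ a , k₁ ⟩ Γ → x ∉supp Γ' → x ∉supp Γ →
              M' ≤M⟨ a , k₂ ⟩ M → (Γ' , x ∶ M') ≤ptw⟨ a , k₁ + k₂ ⟩ (Γ , x ∶ M)
≤ptw-extend {Γ'} {Γ} {x} {M'} {M} {a} {k₂ = k₂} (ptw n v' v w) x∉Γ' x∉Γ wₓ =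
  ptw (n ⊔ suc x)
    (update-vanishes (vanishes-mono v' n≤N) x<N)
    (update-vanishes (vanishes-mono v n≤N) x<N)
    (≤[]-update (≤[]-pad w v' v n≤N) x<N x∉Γ' x∉Γ (update-≢ Γ' x M') (update-≢ Γ x M)
      (subst₂ (_≤M⟨ a , k₂ ⟩_) (≡.sym (update-≡ Γ' x M')) (≡.sym (update-≡ Γ x M)) wₓ))
  where
  n≤N : n ≤ n ⊔ suc x
  n≤N = m≤m⊔n n (suc x)
  x<N : x < n ⊔ suc x
  x<N = m≤n⊔m n (suc x)

≤ptw-extend⁻¹ : ∀ {Γ' Γ x M' M a k} → (Γ' , x ∶ M') ≤ptw⟨ a , k ⟩ (Γ , x ∶ M) →
                x ∉supp Γ' → x ∉supp Γ →
                ∃[ k₁ ] ∃[ k₂ ] (k ≡ k₁ + k₂ × Γ' ≤ptw⟨ a , k₁ ⟩ Γ × M' ≤M⟨ a , k₂ ⟩ M)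
≤ptw-extend⁻¹ {Γ'} {Γ} {x} {M'} {M} {a} (ptw n v' v w) x∉Γ' x∉Γ =
  let k₁ , k₂ , k≡ , w' , wₓ =
        ≤[]-update⁻¹ (≤[]-pad w v' v n≤N) x<N x∉Γ' x∉Γ (update-≢ Γ' x M') (update-≢ Γ x M)
  in k₁ , k₂ , k≡ ,
     ptw (n ⊔ suc x) (update-vanishes⁻¹ (vanishes-mono v' n≤N) x<N)
                     (update-vanishes⁻¹ (vanishes-mono v n≤N) x<N) w' ,
     subst₂ (_≤M⟨ a , k₂ ⟩_) (update-≡ Γ' x M') (update-≡ Γ x M) wₓ
  where
  n≤N : n ≤ n ⊔ suc x
  n≤N = m≤m⊔n n (suc x)
  x<N : x < n ⊔ suc x
  x<N = m≤n⊔m n (suc x)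

≤ptw-trans : ∀ {Δ₁ Δ₂ Δ₃ a k₁ k₂} → Δ₁ ≤ptw⟨ a , k₁ ⟩ Δ₂ → Δ₂ ≤ptw⟨ a , k₂ ⟩ Δ₃ →
             Δ₁ ≤ptw⟨ a , k₁ + k₂ ⟩ Δ₃
≤ptw-trans (ptw n₁ v₁ v₂ w₁) (ptw n₂ u₂ u₃ w₂) =
  ptw (n₁ ⊔ n₂) (vanishes-mono v₁ (m≤m⊔n n₁ n₂)) (vanishes-mono u₃ (m≤n⊔m n₁ n₂))
      (≤[]-trans (≤[]-pad w₁ v₁ v₂ (m≤m⊔n n₁ n₂)) (≤[]-pad w₂ u₂ u₃ (m≤n⊔m n₁ n₂)))

restrict : ℕ → (Var → MType) → Env
restrict zero f = ∅
restrict (suc n) f = restrict n f , n ∶ f n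

restrict-vanishes : ∀ n f → Vanishes n (fun (restrict n f))
restrict-vanishes zero f _ _ = refl
restrict-vanishes (suc n) f = update-vanishes (vanishes-mono (restrict-vanishes n f) (n≤1+n n)) ≤-refl

restrict-agrees : ∀ n f y → y < n → fun (restrict n f) y ≡ f y
restrict-agrees (suc n) f y y<1+n with n ≟ y
... | yes refl = update-≡ (restrict n f) n (f n)
... | no n≢y = ≡.trans (update-≢ (restrict n f) n (f n) y (≢-sym n≢y))
                       (restrict-agrees n f y (<-pred-≢ y<1+n n≢y))

≈E-restrict : ∀ {n Δ} → Vanishes n (fun Δ) → Δ ≈E restrict n (fun Δ)
≈E-restrict {n} {Δ} v y with y <? n
... | yes y<n = ≡⇒≈M (≡.sym (restrict-agrees n (fun Δ) y y<n))
... | no y≮n = ≡⇒≈M (≡.trans (v y (≮⇒≥ y≮n)) (≡.sym (restrict-vanishes n (fun Δ) y (≮⇒≥ y≮n))))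

≤[]⇒≤E-restrict : ∀ {f' f n a k} → f' ≤[ n ]⟨ a , k ⟩ f → restrict n f' ≤E⟨ a , k ⟩ restrict n f
≤[]⇒≤E-restrict [] = emp (λ _ → ≈M-refl) (λ _ → ≈M-refl)
≤[]⇒≤E-restrict {f'} {f} (_∷ʳ_ {n = n} w wₙ) =
  ext (≤[]⇒≤E-restrict w) (restrict-vanishes n f' n ≤-refl) (restrict-vanishes n f n ≤-refl) wₙ
      (λ _ → ≈M-refl) (λ _ → ≈M-refl)

≤E-resp-≈E : ∀ {Δ'₀ Δ₀ Δ' Δ a k} → Δ'₀ ≤E⟨ a , k ⟩ Δ₀ → Δ' ≈E Δ'₀ → Δ ≈E Δ₀ → Δ' ≤E⟨ a , k ⟩ Δ
≤E-resp-≈E (emp e'₀ e₀) e' e = emp (λ y → ≈M-trans (e' y) (e'₀ y)) (λ y → ≈M-trans (e y) (e₀ y))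
≤E-resp-≈E (ext w x∉Γ' x∉Γ wₓ e'₀ e₀) e' e =
  ext w x∉Γ' x∉Γ wₓ (λ y → ≈M-trans (e' y) (e'₀ y)) (λ y → ≈M-trans (e y) (e₀ y))

≤ptw⇒≤E : ∀ {Δ' Δ a k} → Δ' ≤ptw⟨ a , k ⟩ Δ → Δ' ≤E⟨ a , k ⟩ Δ
≤ptw⇒≤E {Δ'} {Δ} (ptw _ v' v w) =
  ≤E-resp-≈E (≤[]⇒≤E-restrict w) (≈E-restrict {Δ = Δ'} v') (≈E-restrict {Δ = Δ} v)

≤E⇒≤ptw : ∀ {Δ' Δ a k} → Δ' ≤E⟨ a , k ⟩ Δ → Δ' ≤ptw⟨ a , k ⟩ Δ
≤E⇒≤ptw (emp e' e) = ptw 0 (λ y _ → ≈M[]⇒≡[] (e' y)) (λ y _ → ≈M[]⇒≡[] (e y)) []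
≤E⇒≤ptw (ext w x∉Γ' x∉Γ wₓ e' e) = ≤ptw-resp-≈E (≤ptw-extend (≤E⇒≤ptw w) x∉Γ' x∉Γ wₓ) e' e

≤E-trans : ∀ {Δ₁ Δ₂ Δ₃ a k₁ k₂} → Δ₁ ≤E⟨ a , k₁ ⟩ Δ₂ → Δ₂ ≤E⟨ a , k₂ ⟩ Δ₃ →
           Δ₁ ≤E⟨ a , k₁ + k₂ ⟩ Δ₃
≤E-trans w₁ w₂ = ≤ptw⇒≤E (≤ptw-trans (≤E⇒≤ptw w₁) (≤E⇒≤ptw w₂))

≤E₀⇒≈E : ∀ {Δ' Δ a k} → Δ' ≤E⟨ a , k ⟩ Δ → k ≡ 0 → Δ' ≈E Δ
≤E₀⇒≈E w k≡0 y with ≤E⇒≤ptw w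
... | ptw n v' v w' with y <? n
... | yes y<n = ≤[]₀⇒≈ w' k≡0 y y<n
... | no y≮n = ≡⇒≈M (≡.trans (v' y (≮⇒≥ y≮n)) (≡.sym (v y (≮⇒≥ y≮n))))

≈E⇒≤E₀ : ∀ {Δ' Δ a} → Δ' ≈E Δ → Δ' ≤E⟨ a , 0 ⟩ Δ
≈E⇒≤E₀ {Δ'} {Δ} e =
  ≤ptw⇒≤E (ptw (bound Δ' ⊔ bound Δ)
                (vanishes-mono (finite Δ') (m≤m⊔n (bound Δ') (bound Δ)))
                (vanishes-mono (finite Δ) (m≤n⊔m (bound Δ') (bound Δ)))
                (≈⇒≤[]₀ (bound Δ' ⊔ bound Δ) (λ y _ → e y)))

≤E-extend⁻¹ : ∀ {Γ' Γ x M' M a k} → (Γ' , x ∶ M') ≤E⟨ a , k ⟩ (Γ , x ∶ M) →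
              x ∉supp Γ' → x ∉supp Γ →
              ∃[ k₁ ] ∃[ k₂ ] (k ≡ k₁ + k₂ × Γ' ≤E⟨ a , k₁ ⟩ Γ × M' ≤M⟨ a , k₂ ⟩ M)
≤E-extend⁻¹ w x∉Γ' x∉Γ =
  let k₁ , k₂ , k≡ , w' , wₓ = ≤ptw-extend⁻¹ (≤E⇒≤ptw w) x∉Γ' x∉Γ
  in k₁ , k₂ , k≡ , ≤ptw⇒≤E w' , wₓ

pair-≤₀⇔≈ : ∀ {Γ Γ' L L' a} → (Γ , L) ≤⟨ a , 0 ⟩ (Γ' , L') ⇔ (Γ ≈E Γ' × L ≈L L')
pair-≤₀⇔≈ = mk⇔
  (λ (k₁ , k₂ , 0≡k , wΓ , wL) →
     ≤E₀⇒≈E wΓ (m+n≡0⇒m≡0 k₁ (≡.sym 0≡k)) , ≤L₀⇒≈L wL (m+n≡0⇒n≡0 k₁ (≡.sym 0≡k)))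
  (λ (eΓ , eL) → 0 , 0 , refl , ≈E⇒≤E₀ eΓ , ≈L⇒≤L₀ eL)

pair-≤-extend⇔arr : ∀ {Γ Γ' L L' M M' x c a k} → x ∉supp Γ → x ∉supp Γ' →
                    ((Γ' , x ∶ M') , L') ≤⟨ a , k ⟩ ((Γ , x ∶ M) , L)
                      ⇔ (Γ' , arr M' c L') ≤⟨ a , k ⟩ (Γ , arr M c L)
pair-≤-extend⇔arr {Γ} {Γ'} {L} {L'} {M} {M'} {x} {c} {a} {k} x∉Γ x∉Γ' = mk⇔ to from
  where
  to : ((Γ' , x ∶ M') , L') ≤⟨ a , k ⟩ ((Γ , x ∶ M) , L) → (Γ' , arr M' c L') ≤⟨ a , k ⟩ (Γ , arr M c L)
  to (_ , k₂ , refl , wΓ , wL) with ≤E-extend⁻¹ wΓ x∉Γ' x∉Γ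
  ... | j₁ , i₁ , refl , wΓ' , wM = j₁ , i₁ + k₂ , +-assoc j₁ i₁ k₂ , wΓ' , arr wM wL

  from : (Γ' , arr M' c L') ≤⟨ a , k ⟩ (Γ , arr M c L) → ((Γ' , x ∶ M') , L') ≤⟨ a , k ⟩ ((Γ , x ∶ M) , L)
  from (j₁ , _ , refl , wΓ , arr {k₁ = i₁} {k₂ = i₂} wM wL) =
    j₁ + i₁ , i₂ , ≡.sym (+-assoc j₁ i₁ i₂) ,
    ext wΓ x∉Γ' x∉Γ wM (λ _ → ≈M-refl) (λ _ → ≈M-refl) , wL

pair-≤-trans : ∀ {Γ₁ Γ₂ Γ₃ L₁ L₂ L₃ a k₁ k₂} →
               (Γ₁ , L₁) ≤⟨ a , k₁ ⟩ (Γ₂ , L₂) → (Γ₂ , L₂) ≤⟨ a , k₂ ⟩ (Γ₃ , L₃) →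
               (Γ₁ , L₁) ≤⟨ a , k₁ + k₂ ⟩ (Γ₃ , L₃)
pair-≤-trans (i₁ , j₁ , refl , wΓ₁ , wL₁) (i₂ , j₂ , refl , wΓ₂ , wL₂) =
  i₁ + i₂ , j₁ + j₂ , interchange i₁ j₁ i₂ j₂ , ≤E-trans wΓ₁ wΓ₂ , ≤L-trans wL₁ wL₂

lemma2 : (Γ Γ' Γ'' : Env) (L L' L'' : LType) (a : Pol) →
    -- (i)
    ((L ≤L⟨ a , 0 ⟩ L' ⇔ L ≈L L')
      × (Γ ≤E⟨ a , 0 ⟩ Γ' ⇔ Γ ≈E Γ')
      × ((Γ , L) ≤⟨ a , 0 ⟩ (Γ' , L') ⇔ (Γ ≈E Γ' × L ≈L L')))
    -- (ii)
    × ((M M' : MType) (x : Var) (c : Color) (k : ℕ) →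
        x ∉supp Γ → x ∉supp Γ' →
        ((Γ' , x ∶ M') , L') ≤⟨ a , k ⟩ ((Γ , x ∶ M) , L)
          ⇔ (Γ' , arr M' c L') ≤⟨ a , k ⟩ (Γ , arr M c L))
    -- (iii)
    × ((k₁ k₂ : ℕ) →
        (Γ , L) ≤⟨ a , k₁ ⟩ (Γ' , L') →
        (Γ' , L') ≤⟨ a , k₂ ⟩ (Γ'' , L'') →
        (Γ , L) ≤⟨ a , k₁ + k₂ ⟩ (Γ'' , L''))
lemma2 _ _ _ _ _ _ _ =
  ( mk⇔ (λ w → ≤L₀⇒≈L w refl) ≈L⇒≤L₀
  , mk⇔ (λ w → ≤E₀⇒≈E w refl) ≈E⇒≤E₀
  , pair-≤₀⇔≈ )
  , (λ _ _ _ _ _ → pair-≤-extend⇔arr)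
  , (λ _ _ → pair-≤-trans)
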